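{- Let $G=G^{(1)}\square\cdots\square G^{(t)}$ be a Cartesian product graph of dimension $t$ (i.e. all $t$ base graphs $G^{(i)}$ have more than one vertex). Let $M\subseteq V(G)$ with $|M|=m\le t$. Then there exist pairwise disjoint projections $H_1,\ldots,H_m$ of $G$, each of dimension at least $t-m+1$, such that every $v\in M$ lies in exactly one of these projections.
   Context: The Cartesian product $G^{(1)}\square\cdots\square G^{(t)}$ has vertex set $V(G^{(1)})\times\cdots\times V(G^{(t)})$, and $u,v$ are adjacent iff there is $i$ with $u_iv_i\in E(G^{(i)})$ and $u_j=v_j$ for all $j\neq i$. A base graph is trivial if it has a single vertex. A projection of $G=\square_{i=1}^t G^{(i)}$ is a subgraph $H=\square_{i=1}^t H^{(i)}$ where for each $i$ either $H^{(i)}=G^{(i)}$ or $H^{(i)}=(\{v_i\},\varnothing)$ for some $v_i\in V(G^{(i)})$. The dimension of such a product $\square_{i=1}^t H^{(i)}$ is the number of its non-trivial factors $H^{(i)}$. -}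

module Defs where

open import Data.Nat using (ℕ; suc; _≤_)
open import Data.Fin using (Fin)
open import Data.Maybe using (Maybe; just; nothing; is-nothing)
open import Data.Bool using (T)
open import Relation.Nullary.Decidable using (T?)
open import Data.Product using (_×_; Σ; ∃; _,_)
open import Data.Sum using (_⊎_)
open import Data.List using (List; length; filter; allFin)
open import Relation.Nullary using (¬_)
open import Relation.Binary.PropositionalEquality using (_≡_; _≢_)
open import Level using (0ℓ)

record Graph : Set₁ where
  field
    size : ℕ
    Adj  : Fin size → Fin size → Set
    Adj-sym   : ∀ {x y} → Adj x y → Adj y x
    Adj-irrefl : ∀ {x} → ¬ Adj x x
open Graph public

Factors : ℕ → Set₁
Factors t = Fin t → Graph

Vertex : ∀ {t} → Factors t → Set
Vertex {t} G = (i : Fin t) → Fin (size (G i))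

ProdAdj : ∀ {t} (G : Factors t) → Vertex G → Vertex G → Set
ProdAdj {t} G u v =
  Σ (Fin t) λ i → Adj (G i) (u i) (v i) × (∀ j → j ≢ i → u j ≡ v j)

HasDimension : ∀ {t} → Factors t → Set
HasDimension {t} G = ∀ i → 2 ≤ size (G i)

-- A projection H = □ H⁽ⁱ⁾: for each i, H⁽ⁱ⁾ = G⁽ⁱ⁾ (nothing)
-- or H⁽ⁱ⁾ = ({vᵢ}, ∅) (just vᵢ).  (Its edges are those of G between its
-- vertices, so it is determined by its vertex set.)
Projection : ∀ {t} → Factors t → Set
Projection {t} G = (i : Fin t) → Maybe (Fin (size (G i)))

infix 4 _∈P_
_∈P_ : ∀ {t} {G : Factors t} → Vertex G → Projection G → Set
_∈P_ {t} {G} v H = ∀ i → ∀ x → H i ≡ just x → v i ≡ x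

-- Dimension of a projection: number of its non-trivial factors, i.e. the
-- number of i with H⁽ⁱ⁾ = G⁽ⁱ⁾ (these have ≥ 2 vertices under HasDimension).
dim : ∀ {t} {G : Factors t} → Projection G → ℕ
dim {t} H = length (filter (λ i → T? (is-nothing (H i))) (allFin t))

{-# OPTIONS --safe #-}
-- The invariant is a family of m pairwise disjoint projections,
-- each of dimension at least t − m + 1, covering M, and such that all points of M
-- in one part coincide. To add a point p:
-- * if p lies in some part H, cut H along a free coordinate c into the slice
--   c = p c and a slice c = x; when H already contains a point q ≠ p, c is taken
--   where q and p differ (such a c is necessarily free in H) and x = q c;
-- * otherwise each part Hⱼ fixes some coordinate cⱼ to a value other than p cⱼ,
--   and the projection through p fixing the m coordinates cⱼ is a new part
--   disjoint from all the others.
-- Either way every dimension drops by at most one.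
module Submission where

open import Defs
open import Data.Nat using (ℕ; zero; suc; _≤_; _<_; s≤s⁻¹; _∸_; _+_; z≤n; s≤s)
open import Data.Nat.Properties
  using (m≤n⇒m≤1+n; n≤1+n; ≤-trans; ≤-reflexive; 1+n≰n; +-comm; +-suc; +-identityʳ;
         +-∸-comm; m≤n+o⇒m∸n≤o; +-monoˡ-≤; +-monoʳ-≤; module ≤-Reasoning)
open import Data.Fin using (Fin; zero; suc; punchIn; _≟_)
open import Data.Fin.Properties using (all?; any?; ¬∀⟶∃¬; punchInᵢ≢i; suc-injective)
open import Data.Bool using (T)
open import Data.Maybe using (Maybe; just; nothing; is-nothing)
open import Data.Maybe.Properties using (just-injective)
open import Data.List using (length; filter; tabulate)
open import Data.List.Properties using (filter-all; length-tabulate)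
import Data.List.Relation.Unary.All.Properties as All
open import Data.Vec.Functional using (_∷_; head; tail; updateAt)
open import Data.Vec.Functional.Properties using (updateAt-updates; updateAt-minimal)
open import Data.Product using (_×_; Σ; ∃-syntax; _,_; proj₁; proj₂)
import Data.Product as Product
open import Data.Sum using (_⊎_; inj₁; inj₂)
open import Data.Empty using (⊥-elim)
open import Function using (_∘_; id)
open import Relation.Nullary using (¬_; Dec; yes; no; contradiction)
open import Relation.Nullary.Decidable using (T?)
open import Relation.Unary using (Pred; Decidable)
open import Relation.Binary.PropositionalEquality
open import Function.Definitions using (Injective)
open import Level using (0ℓ)

module _ {A : Set} {P : Pred A 0ℓ} (P? : Decidable P) where

  length-filter-tabulate-pos : ∀ {k} (g : Fin k → A) →
    1 ≤ length (filter P? (tabulate g)) → ∃[ i ] P (g i)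
  length-filter-tabulate-pos {suc k} g pos with P? (g zero)
  ... | yes p = zero , p
  ... | no _  = Product.map suc id (length-filter-tabulate-pos (g ∘ suc) pos)

module _ {A : Set} {P Q : Pred A 0ℓ} (P? : Decidable P) (Q? : Decidable Q) where

  length-filter-tabulate-mono : ∀ {k} (g : Fin k → A) → (∀ i → P (g i) → Q (g i)) →
    length (filter P? (tabulate g)) ≤ length (filter Q? (tabulate g))
  length-filter-tabulate-mono {zero} g P⇒Q = z≤n
  length-filter-tabulate-mono {suc k} g P⇒Q with P? (g zero) | Q? (g zero)
  ... | yes _ | yes _ = s≤s (length-filter-tabulate-mono (g ∘ suc) (P⇒Q ∘ suc))
  ... | no _  | yes _ = m≤n⇒m≤1+n (length-filter-tabulate-mono (g ∘ suc) (P⇒Q ∘ suc))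
  ... | no _  | no _  = length-filter-tabulate-mono (g ∘ suc) (P⇒Q ∘ suc)
  ... | yes p | no ¬q = contradiction (P⇒Q zero p) ¬q

  length-filter-tabulate-≤-suc : ∀ {k} (g : Fin k → A) (c : Fin k) →
    (∀ i → i ≢ c → P (g i) → Q (g i)) →
    length (filter P? (tabulate g)) ≤ suc (length (filter Q? (tabulate g)))
  length-filter-tabulate-≤-suc {suc k} g zero P⇒Q
    with length-filter-tabulate-mono (g ∘ suc) (λ i → P⇒Q (suc i) λ ())
  ... | tail-mono with P? (g zero) | Q? (g zero)
  ... | yes _ | yes _ = s≤s (m≤n⇒m≤1+n tail-mono)
  ... | yes _ | no _  = s≤s tail-mono
  ... | no _  | yes _ = m≤n⇒m≤1+n (m≤n⇒m≤1+n tail-mono)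
  ... | no _  | no _  = m≤n⇒m≤1+n tail-mono
  length-filter-tabulate-≤-suc {suc k} g (suc c) P⇒Q
    with length-filter-tabulate-≤-suc (g ∘ suc) c (λ i i≢c → P⇒Q (suc i) (i≢c ∘ suc-injective))
  ... | ih with P? (g zero) | Q? (g zero)
  ... | yes _ | yes _ = s≤s ih
  ... | no _  | yes _ = m≤n⇒m≤1+n ih
  ... | no _  | no _  = ih
  ... | yes p | no ¬q = contradiction (P⇒Q zero (λ ()) p) ¬q

another : ∀ {n} → 2 ≤ n → (x : Fin n) → ∃[ y ] y ≢ x
another (s≤s (s≤s _)) x = punchIn x zero , punchInᵢ≢i x zero

-- v ∈P H unfolds to ∀ i → Admits (H i) (v i).
Admits : ∀ {A : Set} → Maybe A → A → Set
Admits m y = ∀ x → m ≡ just x → y ≡ x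

admits? : ∀ {n} (m : Maybe (Fin n)) y → Dec (Admits m y)
admits? nothing  y = yes λ _ ()
admits? (just z) y with y ≟ z
... | yes y≡z = yes λ { x refl → y≡z }
... | no y≢z  = no λ adm → y≢z (adm z refl)

¬Admits⇒just : ∀ {A : Set} {m : Maybe A} {y} → ¬ Admits m y → ∃[ x ] m ≡ just x × y ≢ x
¬Admits⇒just {m = nothing} ¬adm = contradiction (λ _ ()) ¬adm
¬Admits⇒just {m = just z}  ¬adm = z , refl , λ y≡z → ¬adm λ { x refl → y≡z }

T-is-nothing : ∀ {A : Set} {m : Maybe A} → T (is-nothing m) → m ≡ nothing
T-is-nothing {m = nothing} _ = refl

m≤n⇒1+n≤o+m⇒n∸m+1≤o : ∀ {t m d} → m ≤ t → suc t ≤ d + m → t ∸ m + 1 ≤ d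
m≤n⇒1+n≤o+m⇒n∸m+1≤o {t} {m} {d} m≤t h = begin
  t ∸ m + 1   ≡⟨ +-∸-comm 1 m≤t ⟨
  (t + 1) ∸ m ≡⟨ cong (_∸ m) (+-comm t 1) ⟩
  suc t ∸ m   ≤⟨ m≤n+o⇒m∸n≤o (suc t) m (subst (suc t ≤_) (+-comm d m) h) ⟩
  d           ∎
  where open ≤-Reasoning

m≤n⇒1+n≤o+m⇒0<o : ∀ {m n o} → m ≤ n → suc n ≤ o + m → 0 < o
m≤n⇒1+n≤o+m⇒0<o {o = zero}  m≤n 1+n≤m = contradiction (≤-trans 1+n≤m m≤n) 1+n≰n
m≤n⇒1+n≤o+m⇒0<o {o = suc o} _   _     = s≤s z≤n

module _ {t} (G : Factors t) where

  infix 4 _∈_ _⊆_ _≈_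

  _≈_ : Vertex G → Vertex G → Set
  u ≈ v = ∀ i → u i ≡ v i

  _∈_ : Vertex G → Projection G → Set
  v ∈ H = _∈P_ {G = G} v H

  _⊆_ : Projection G → Projection G → Set
  H ⊆ K = ∀ {v} → v ∈ H → v ∈ K

  Disjoint : Projection G → Projection G → Set
  Disjoint H K = ∀ v → v ∈ H → ¬ v ∈ K

  PairwiseDisjoint : ∀ {m} → (Fin m → Projection G) → Set
  PairwiseDisjoint H = ∀ j k → j ≢ k → Disjoint (H j) (H k)

  dimension : Projection G → ℕ
  dimension H = dim {G = G} H

  full : Projection G
  full _ = nothing

  fixAt : Projection G → (c : Fin t) → Fin (size (G c)) → Projection G
  fixAt H c x i with i ≟ c
  ... | yes refl = just x
  ... | no _     = H i

  fixAt-≢ : ∀ H c x {i} → i ≢ c → fixAt H c x i ≡ H i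
  fixAt-≢ H c x {i} i≢c with i ≟ c
  ... | yes i≡c = contradiction i≡c i≢c
  ... | no _    = refl

  fixAt-≡ : ∀ H c x → fixAt H c x c ≡ just x
  fixAt-≡ H c x with c ≟ c
  ... | yes refl = refl
  ... | no c≢c   = contradiction refl c≢c

  _∈?_ : ∀ v H → Dec (v ∈ H)
  v ∈? H = all? λ i → admits? (H i) (v i)

  ∉⇒separated : ∀ {v H} → ¬ v ∈ H → ∃[ i ] ∃[ x ] H i ≡ just x × v i ≢ x
  ∉⇒separated {v} {H} v∉H =
    Product.map₂ ¬Admits⇒just (¬∀⟶∃¬ t _ (λ i → admits? (H i) (v i)) v∉H)

  differ⇒free : ∀ {u v H c} → u ∈ H → v ∈ H → u c ≢ v c → H c ≡ nothing
  differ⇒free {H = H} {c} u∈H v∈H u≢v with H c in eq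
  ... | nothing = refl
  ... | just x  = contradiction (trans (u∈H c x eq) (sym (v∈H c x eq))) u≢v

  ≈-or-differ : ∀ (u v : Vertex G) → u ≈ v ⊎ ∃[ i ] u i ≢ v i
  ≈-or-differ u v with all? (λ i → u i ≟ v i)
  ... | yes u≈v = inj₁ u≈v
  ... | no u≉v  = inj₂ (¬∀⟶∃¬ t _ (λ i → u i ≟ v i) u≉v)

  ∈-fixAt⁺ : ∀ {v H c x} → v ∈ H → v c ≡ x → v ∈ fixAt H c x
  ∈-fixAt⁺ {c = c} v∈H vc≡x i y eq with i ≟ c
  ... | yes refl = trans vc≡x (just-injective eq)
  ... | no _     = v∈H i y eq

  ∈-fixAt⁻ : ∀ {v H c x} → v ∈ fixAt H c x → v c ≡ x
  ∈-fixAt⁻ {H = H} {c} {x} v∈ = v∈ c x (fixAt-≡ H c x)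

  fixAt-⊆ : ∀ {H c x} → Admits (H c) x → fixAt H c x ⊆ H
  fixAt-⊆ {H} {c} {x} adm {v} v∈ i y eq with i ≟ c | v∈ i
  ... | yes refl | _       = trans (∈-fixAt⁻ {v} {H} v∈) (adm y eq)
  ... | no _     | v∈ᵢ     = v∈ᵢ y eq

  Free? : (H : Projection G) → Decidable (λ i → T (is-nothing (H i)))
  Free? H i = T? (is-nothing (H i))

  dimension-full : dimension full ≡ t
  dimension-full =
    trans (cong length (filter-all (Free? full) (All.tabulate⁺ {f = id} _))) (length-tabulate {n = t} id)

  dimension-fixAt : ∀ H c x → dimension H ≤ suc (dimension (fixAt H c x))
  dimension-fixAt H c x = length-filter-tabulate-≤-suc (Free? H) (Free? (fixAt H c x)) id c
    (λ i i≢c → subst (T ∘ is-nothing) (sym (fixAt-≢ H c x i≢c)))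

  large-fixAt : ∀ {n m} H c x → n ≤ dimension H + m → n ≤ dimension (fixAt H c x) + suc m
  large-fixAt {n} {m} H c x n≤ = begin
    n                                 ≤⟨ n≤ ⟩
    dimension H + m                   ≤⟨ +-monoˡ-≤ m (dimension-fixAt H c x) ⟩
    suc (dimension (fixAt H c x)) + m ≡⟨ +-suc _ m ⟨
    dimension (fixAt H c x) + suc m   ∎
    where open ≤-Reasoning

  free-coordinate : ∀ H → 1 ≤ dimension H → ∃[ c ] H c ≡ nothing
  free-coordinate H pos = Product.map₂ T-is-nothing (length-filter-tabulate-pos (Free? H) id pos)

  fixAll : Vertex G → ∀ {k} → (Fin k → Fin t) → Projection G
  fixAll p {zero}  cs = full
  fixAll p {suc k} cs = fixAt (fixAll p (tail cs)) (head cs) (p (head cs))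

  ∈-fixAll : ∀ p {k} (cs : Fin k → Fin t) → p ∈ fixAll p cs
  ∈-fixAll p {zero}  cs i x ()
  ∈-fixAll p {suc k} cs = ∈-fixAt⁺ (∈-fixAll p (tail cs)) refl

  ∈-fixAll⁻ : ∀ {v} p {k} (cs : Fin k → Fin t) → v ∈ fixAll p cs → ∀ j → v (cs j) ≡ p (cs j)
  ∈-fixAll⁻ p cs v∈ zero    = ∈-fixAt⁻ {H = fixAll p (tail cs)} v∈
  ∈-fixAll⁻ p cs v∈ (suc j) =
    ∈-fixAll⁻ p (tail cs) (fixAt-⊆ (∈-fixAll p (tail cs) (head cs)) v∈) j

  large-fixAll : ∀ p {k} (cs : Fin k → Fin t) → t ≤ dimension (fixAll p cs) + k
  large-fixAll p {zero}  cs = ≤-reflexive (sym (trans (+-identityʳ _) dimension-full))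
  large-fixAll p {suc k} cs = large-fixAt _ (head cs) _ (large-fixAll p (tail cs))

  member-unique : ∀ {m} {H : Fin m → Projection G} → PairwiseDisjoint H →
    ∀ {v j k} → v ∈ H k → v ∈ H j → k ≡ j
  member-unique disj {v} {j} {k} v∈k v∈j with k ≟ j
  ... | yes k≡j = k≡j
  ... | no k≢j  = contradiction v∈j (disj k j k≢j v v∈k)

  record Separation {m} (M : Fin m → Vertex G) : Set where
    field
      part     : Fin m → Projection G
      disjoint : PairwiseDisjoint part
      -- dimension (part j) ≥ t − m + 1, stated without truncated subtraction
      large    : ∀ j → suc t ≤ dimension (part j) + m
      covers   : ∀ a → ∃[ j ] M a ∈ part j
      pure     : ∀ j {a b} → M a ∈ part j → M b ∈ part j → M a ≈ M b

  separation-zero : (M : Fin 0 → Vertex G) → Separation M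
  separation-zero M = record
    { part = λ () ; disjoint = λ () ; large = λ () ; covers = λ () ; pure = λ () }

  module _ {m} {M : Fin (suc m) → Vertex G} (s : Separation (tail M)) where
    open Separation s

    record Extension : Set where
      field
        new           : Projection G
        shrunk        : Fin m → Projection G
        shrunk⊆part   : ∀ k → shrunk k ⊆ part k
        new-disjoint  : ∀ k → Disjoint new (shrunk k)
        new-large     : suc t ≤ dimension new + suc m
        shrunk-large  : ∀ k → suc t ≤ dimension (shrunk k) + suc m
        head∈new      : head M ∈ new
        new-pure      : ∀ {b} → tail M b ∈ new → tail M b ≈ head M
        new-or-shrunk : ∀ b → tail M b ∈ new ⊎ ∃[ k ] tail M b ∈ shrunk k

    extension⇒separation : Extension → Separation M
    extension⇒separation e = record
      { part = new ∷ shrunk ; disjoint = disjoint′ ; large = large′ ; covers = covers′ ; pure = pure′ }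
      where
      open Extension e

      disjoint′ : PairwiseDisjoint (new ∷ shrunk)
      disjoint′ zero    zero    0≢0 = contradiction refl 0≢0
      disjoint′ zero    (suc k) _   = new-disjoint k
      disjoint′ (suc k) zero    _   v v∈k v∈new = new-disjoint k v v∈new v∈k
      disjoint′ (suc k) (suc l) k≢l v v∈k v∈l =
        disjoint k l (k≢l ∘ cong suc) v (shrunk⊆part k v∈k) (shrunk⊆part l v∈l)

      large′ : ∀ l → suc t ≤ dimension ((new ∷ shrunk) l) + suc m
      large′ zero    = new-large
      large′ (suc k) = shrunk-large k

      covers′ : ∀ a → ∃[ l ] M a ∈ (new ∷ shrunk) l
      covers′ zero    = zero , head∈new
      covers′ (suc b) with new-or-shrunk b
      ... | inj₁ b∈new       = zero , b∈new
      ... | inj₂ (k , b∈k)   = suc k , b∈k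

      pure′ : ∀ l {a b} → M a ∈ (new ∷ shrunk) l → M b ∈ (new ∷ shrunk) l → M a ≈ M b
      pure′ zero    {zero}  {zero}  _   _   _ = refl
      pure′ zero    {zero}  {suc b} _   b∈  i = sym (new-pure b∈ i)
      pure′ zero    {suc a} {zero}  a∈  _     = new-pure a∈
      pure′ zero    {suc a} {suc b} a∈  b∈  i = trans (new-pure a∈ i) (sym (new-pure b∈ i))
      pure′ (suc k) {zero}          a∈  _     = ⊥-elim (new-disjoint k _ head∈new a∈)
      pure′ (suc k) {suc a} {zero}  _   b∈    = ⊥-elim (new-disjoint k _ head∈new b∈)
      pure′ (suc k) {suc a} {suc b} a∈  b∈    = pure k (shrunk⊆part k a∈) (shrunk⊆part k b∈)

    extension-through-head : (∀ j → ¬ head M ∈ part j) → Extension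
    extension-through-head p∉ = record
      { new           = fixAll (head M) cs
      ; shrunk        = part
      ; shrunk⊆part   = λ _ → id
      ; new-disjoint  = separated
      ; new-large     = subst (suc t ≤_) (sym (+-suc _ m)) (s≤s (large-fixAll (head M) cs))
      ; shrunk-large  = λ k → ≤-trans (large k) (+-monoʳ-≤ _ (n≤1+n m))
      ; head∈new      = ∈-fixAll (head M) cs
      ; new-pure      = λ {b} b∈ → ⊥-elim (separated (proj₁ (covers b)) _ b∈ (proj₂ (covers b)))
      ; new-or-shrunk = inj₂ ∘ covers
      }
      where
      separator : ∀ j → ∃[ i ] ∃[ x ] part j i ≡ just x × head M i ≢ x
      separator j = ∉⇒separated (p∉ j)

      cs : Fin m → Fin t
      cs j = proj₁ (separator j)

      separated : ∀ k → Disjoint (fixAll (head M) cs) (part k)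
      separated k v v∈new v∈k =
        let (i , x , eq , p≢x) = separator k
        in p≢x (trans (sym (∈-fixAll⁻ (head M) cs v∈new k)) (v∈k i x eq))

    -- Cutting part j into the slices coord = head M coord (the new part) and coord = value.
    record Cut (j : Fin m) : Set where
      field
        coord      : Fin t
        value      : Fin (size (G coord))
        coord-free : part j coord ≡ nothing
        value≢head : value ≢ head M coord
        sides      : ∀ {b} → tail M b ∈ part j → tail M b ≈ head M ⊎ tail M b coord ≡ value

    extension-by-cut : ∀ {j} → head M ∈ part j → Cut j → Extension
    extension-by-cut {j} p∈j cut = record
      { new           = fixAt (part j) c (p c)
      ; shrunk        = shrunk
      ; shrunk⊆part   = shrunk⊆part
      ; new-disjoint  = new-disjoint
      ; new-large     = large-fixAt (part j) c (p c) (large j)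
      ; shrunk-large  = shrunk-large
      ; head∈new      = ∈-fixAt⁺ p∈j refl
      ; new-pure      = new-pure
      ; new-or-shrunk = new-or-shrunk
      }
      where
      open Cut cut renaming (coord to c; value to x)

      p : Vertex G
      p = head M

      shrunk : Fin m → Projection G
      shrunk = updateAt part j (λ H → fixAt H c x)

      shrunk-cases : ∀ k → (k ≡ j × shrunk k ≡ fixAt (part j) c x) ⊎ (k ≢ j × shrunk k ≡ part k)
      shrunk-cases k with k ≟ j
      ... | yes refl = inj₁ (refl , updateAt-updates j part)
      ... | no k≢j   = inj₂ (k≢j , updateAt-minimal k j part k≢j)

      admits-free : ∀ {y} → Admits (part j c) y
      admits-free y eq with trans (sym coord-free) eq
      ... | ()

      shrunk⊆part : ∀ k → shrunk k ⊆ part k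
      shrunk⊆part k {v} v∈ with shrunk-cases k
      ... | inj₁ (refl , eq) = fixAt-⊆ admits-free (subst (v ∈_) eq v∈)
      ... | inj₂ (_ , eq)    = subst (v ∈_) eq v∈

      new-disjoint : ∀ k → Disjoint (fixAt (part j) c (p c)) (shrunk k)
      new-disjoint k v v∈new v∈k with shrunk-cases k
      ... | inj₁ (refl , eq) = value≢head
        (trans (sym (∈-fixAt⁻ {H = part j} (subst (v ∈_) eq v∈k))) (∈-fixAt⁻ {H = part j} v∈new))
      ... | inj₂ (k≢j , eq)  =
        disjoint j k (k≢j ∘ sym) v (fixAt-⊆ admits-free v∈new) (subst (v ∈_) eq v∈k)

      shrunk-large : ∀ k → suc t ≤ dimension (shrunk k) + suc m
      shrunk-large k with shrunk-cases k
      ... | inj₁ (refl , eq) = subst (λ H → suc t ≤ dimension H + suc m) (sym eq)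
                                 (large-fixAt (part j) c x (large j))
      ... | inj₂ (_ , eq)    = subst (λ H → suc t ≤ dimension H + suc m) (sym eq)
                                 (≤-trans (large k) (+-monoʳ-≤ _ (n≤1+n m)))

      new-pure : ∀ {b} → tail M b ∈ fixAt (part j) c (p c) → tail M b ≈ p
      new-pure b∈new with sides (fixAt-⊆ admits-free b∈new)
      ... | inj₁ b≈p  = b≈p
      ... | inj₂ bc≡x = contradiction (trans (sym bc≡x) (∈-fixAt⁻ {H = part j} b∈new)) value≢head

      new-or-shrunk : ∀ b → tail M b ∈ fixAt (part j) c (p c) ⊎ ∃[ k ] tail M b ∈ shrunk k
      new-or-shrunk b with covers b
      ... | k , b∈k with shrunk-cases k
      ...   | inj₂ (_ , eq) = inj₂ (k , subst (_ ∈_) (sym eq) b∈k)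
      ...   | inj₁ (refl , eq) with sides b∈k
      ...     | inj₁ b≈p  = inj₁ (∈-fixAt⁺ b∈k (b≈p c))
      ...     | inj₂ bc≡x = inj₂ (j , subst (_ ∈_) (sym eq) (∈-fixAt⁺ b∈k bc≡x))

    cut-anywhere : HasDimension G → m ≤ t → ∀ {j} →
      (∀ {b} → tail M b ∈ part j → tail M b ≈ head M) → Cut j
    cut-anywhere hd m≤t {j} all≈head = record
      { coord = c ; value = proj₁ y ; coord-free = c-free ; value≢head = proj₂ y ; sides = inj₁ ∘ all≈head }
      where
      free : ∃[ c ] part j c ≡ nothing
      free = free-coordinate (part j) (m≤n⇒1+n≤o+m⇒0<o m≤t (large j))
      c = proj₁ free
      c-free = proj₂ free
      y : ∃[ y ] y ≢ head M c
      y = another (hd c) (head M c)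

    find-cut : HasDimension G → m ≤ t → ∀ {j} → head M ∈ part j → Cut j
    find-cut hd m≤t {j} p∈j with any? (λ b → tail M b ∈? part j)
    ... | no none = cut-anywhere hd m≤t λ b∈ → ⊥-elim (none (_ , b∈))
    ... | yes (b , q∈) with ≈-or-differ (tail M b) (head M)
    ...   | inj₁ q≈p       = cut-anywhere hd m≤t λ b′∈ i → trans (pure j b′∈ q∈ i) (q≈p i)
    ...   | inj₂ (c , q≢p) = record
      { coord = c ; value = tail M b c ; coord-free = differ⇒free q∈ p∈j q≢p
      ; value≢head = q≢p ; sides = λ b′∈ → inj₂ (pure j b′∈ q∈ c) }

    extend : HasDimension G → m ≤ t → Separation M
    extend hd m≤t with any? (λ j → head M ∈? part j)
    ... | yes (j , p∈j) = extension⇒separation (extension-by-cut p∈j (find-cut hd m≤t p∈j))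
    ... | no p∉         = extension⇒separation (extension-through-head λ j p∈j → p∉ (j , p∈j))

  separation : HasDimension G → ∀ {m} → m ≤ suc t → (M : Fin m → Vertex G) → Separation M
  separation hd {zero}  _ M = separation-zero M
  separation hd {suc m} 1+m≤1+t M =
    extend (separation hd (≤-trans (n≤1+n m) 1+m≤1+t) (tail M)) hd (s≤s⁻¹ 1+m≤1+t)

lemma4p1 : (t : ℕ) (G : Factors t) → HasDimension G →
    (m : ℕ) (M : Fin m → Vertex G) → Injective _≡_ _≡_ M → m ≤ t →
    Σ (Fin m → Projection G) λ H →
      (∀ j k → j ≢ k → ∀ v → _∈P_ {G = G} v (H j) → ¬ (_∈P_ {G = G} v (H k)))
      × (∀ j → (t ∸ m) + 1 ≤ dim {G = G} (H j))
      × (∀ a → Σ (Fin m) λ j → _∈P_ {G = G} (M a) (H j) × (∀ k → _∈P_ {G = G} (M a) (H k) → k ≡ j))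
lemma4p1 t G hd m M _ m≤t =
  part , disjoint , (λ j → m≤n⇒1+n≤o+m⇒n∸m+1≤o m≤t (large j)) , exactly-one
  where
  open Separation (separation G hd (m≤n⇒m≤1+n m≤t) M)

  exactly-one : ∀ a → Σ (Fin m) λ j → _∈P_ {G = G} (M a) (part j)
    × (∀ k → _∈P_ {G = G} (M a) (part k) → k ≡ j)
  exactly-one a =
    let (j , a∈j) = covers a in j , a∈j , λ k a∈k → member-unique G disjoint a∈k a∈j
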